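{- Let $\Gamma$ be a simplicial complex and $k$ a nonnegative integer. If $S(\Gamma)=\sum_{i=1}^m c_i\Gamma_i$ with $c_i\in\mathbb{K}$ and simplicial complexes $\Gamma_i$, then $S(\Gamma^{(k)})=\sum_{i=1}^m c_i\Gamma_i^{(k)}$.
   Context: $\mathcal{A}=\bigoplus_{n\ge0}A_n$ is the Hopf algebra over a field $\mathbb{K}$ where $A_n$ is spanned by isomorphism classes of finite simplicial complexes on $n$ vertices; product is disjoint union, unit is the empty complex, coproduct $\Delta(\Gamma)=\sum_{T\subseteq V(\Gamma)}\Gamma_T\otimes\Gamma_{V(\Gamma)-T}$ where $\Gamma_T=\{X\cap T:X\in\Gamma\}$ and $V(\Gamma)$ is the vertex set, counit $\epsilon(\Gamma)=\delta_{\Gamma,\varnothing}$. $S$ denotes its antipode. The $k$-skeleton $\Gamma^{(k)}$ is the set of faces of $\Gamma$ of dimension (size minus one) at most $k$. -}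

module Defs where

open import Level using (Level; _⊔_) renaming (suc to lsuc)
open import Data.Bool using (Bool; true; false; _∧_; _∨_; not; T)
open import Data.Bool.Base using (_≤_; b≤b; f≤t)
open import Data.Unit using (tt)
open import Data.Empty using (⊥)
open import Data.Nat using (ℕ; zero; suc; _+_; _≤ᵇ_; z≤n; s≤s)
import Data.Nat as ℕ
open import Data.Nat.Properties using (≤ᵇ⇒≤; ≤⇒≤ᵇ; ≤-trans; n≤1+n)
open import Data.Fin using (Fin)
open import Data.Fin.Subset using (Subset)
open import Data.Vec using (Vec; []; _∷_; replicate; tabulate; lookup; map)
open import Data.Vec.Relation.Binary.Pointwise.Inductive using (Pointwise; []; _∷_)
open import Data.List using (List; []; _∷_; [_]; concatMap; filterᵇ; foldr)
import Data.List as L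
open import Data.Product using (Σ; _×_; _,_; proj₁; proj₂)
open import Function.Bundles using (_↔_; Inverse)
open import Relation.Binary.PropositionalEquality using (_≡_; refl)
open import Relation.Nullary using (¬_)
open import Algebra.Bundles using (CommutativeRing)

record Field (c ℓ : Level) : Set (lsuc (c ⊔ ℓ)) where
  field
    commutativeRing : CommutativeRing c ℓ
  open CommutativeRing commutativeRing public
  field
    1≉0     : ¬ (1# ≈ 0#)
    inverse : ∀ x → ¬ (x ≈ 0#) → Σ Carrier λ y → (x * y) ≈ 1#

_⊑_ : ∀ {n} → Subset n → Subset n → Set
X ⊑ Y = Pointwise _≤_ X Y

∅ : ∀ n → Subset n
∅ n = replicate n false

card : ∀ {n} → Subset n → ℕ
card []          = 0
card (true ∷ X)  = suc (card X)
card (false ∷ X) = card X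

isEmpty : ∀ {n} → Subset n → Bool
isEmpty []          = true
isEmpty (true ∷ X)  = false
isEmpty (false ∷ X) = isEmpty X

∁ : ∀ {n} → Subset n → Subset n
∁ = map not

-- the order preserving identification of Fin (card T) with T ⊆ Fin n:
-- a subset of Fin (card T) is sent to the corresponding subset of T
embed : ∀ {n} (U : Subset n) → Subset (card U) → Subset n
embed []          []      = []
embed (true ∷ U)  (y ∷ Y) = y ∷ embed U Y
embed (false ∷ U) Y       = false ∷ embed U Y

split : ∀ n {m} → Subset (n + m) → Subset n × Subset m
split zero    Z       = [] , Z
split (suc n) (z ∷ Z) = let (X , Y) = split n Z in (z ∷ X) , Y

subsets : ∀ n → List (Subset n)
subsets zero    = [ [] ]
subsets (suc n) = concatMap (λ X → (false ∷ X) ∷ (true ∷ X) ∷ []) (subsets n)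

nonemptySubsets : ∀ n → List (Subset n)
nonemptySubsets n = filterᵇ (λ X → not (isEmpty X)) (subsets n)

record Complex (n : ℕ) : Set where
  field
    face        : Subset n → Bool
    emptyFace   : T (face (∅ n))
    downClosed  : ∀ {X Y} → X ⊑ Y → T (face Y) → T (face X)
open Complex public

private
  embed-∅ : ∀ {n} (U : Subset n) → embed U (∅ (card U)) ≡ ∅ n
  embed-∅ []          = refl
  embed-∅ (true ∷ U)  rewrite embed-∅ U = refl
  embed-∅ (false ∷ U) rewrite embed-∅ U = refl

  embed-mono : ∀ {n} (U : Subset n) {X Y} → X ⊑ Y → embed U X ⊑ embed U Y
  embed-mono []          []       = []
  embed-mono (true ∷ U)  (p ∷ ps) = p ∷ embed-mono U ps
  embed-mono (false ∷ U) ps       = b≤b ∷ embed-mono U ps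

  card-mono : ∀ {n} {X Y : Subset n} → X ⊑ Y → card X ℕ.≤ card Y
  card-mono []            = z≤n
  card-mono (b≤b {true} ∷ ps)  = s≤s (card-mono ps)
  card-mono (b≤b {false} ∷ ps) = card-mono ps
  card-mono (f≤t ∷ ps)    = ≤-trans (card-mono ps) (n≤1+n _)

  isEmpty-mono : ∀ {n} {X Y : Subset n} → X ⊑ Y → T (isEmpty Y) → T (isEmpty X)
  isEmpty-mono []                 e = e
  isEmpty-mono (b≤b {false} ∷ ps) e = isEmpty-mono ps e
  isEmpty-mono (b≤b {true} ∷ ps)  ()
  isEmpty-mono (f≤t ∷ ps)         ()

  isEmpty-∅ : ∀ n → T (isEmpty (∅ n))
  isEmpty-∅ zero    = tt
  isEmpty-∅ (suc n) = isEmpty-∅ n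

  split-∅ : ∀ n {m} → split n {m} (∅ (n + m)) ≡ (∅ n , ∅ m)
  split-∅ zero    = refl
  split-∅ (suc n) {m} rewrite split-∅ n {m} = refl

  split-mono : ∀ n {m} {Z W : Subset (n + m)} → Z ⊑ W →
               (proj₁ (split n Z) ⊑ proj₁ (split n W)) × (proj₂ (split n Z) ⊑ proj₂ (split n W))
  split-mono zero    ps       = [] , ps
  split-mono (suc n) (p ∷ ps) = let (a , b) = split-mono n ps in (p ∷ a) , b

  T-∧-intro : ∀ {a b} → T a → T b → T (a ∧ b)
  T-∧-intro {true} {true} _ _ = tt

  T-∧-l : ∀ {a b} → T (a ∧ b) → T a
  T-∧-l {true} _ = tt

  T-∧-r : ∀ {a b} → T (a ∧ b) → T b
  T-∧-r {true} t = t

  T-∨-l : ∀ {a b} → T a → T (a ∨ b)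
  T-∨-l {true} _ = tt

  T-∨-r : ∀ {a b} → T b → T (a ∨ b)
  T-∨-r {true} _ = tt
  T-∨-r {false} t = t

  T-∨-elim : ∀ {a b} {ℓ} {C : Set ℓ} → T (a ∨ b) → (T a → C) → (T b → C) → C
  T-∨-elim {true}  t f g = f tt
  T-∨-elim {false} t f g = g t

-- the restriction Γ_U = {X ∩ U : X ∈ Γ}, a complex on the vertex set U,
-- identified with Fin (card T) in an order preserving way.  Since Γ is
-- closed under subsets, {X ∩ T : X ∈ Γ} is the set of faces of Γ inside T.
restrict : ∀ {n} → Complex n → (U : Subset n) → Complex (card U)
restrict Γ U = record
  { face       = λ Y → face Γ (embed U Y)
  ; emptyFace  = emptyFace′
  ; downClosed = λ p → downClosed Γ (embed-mono U p)
  }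
  where
  emptyFace′ : T (face Γ (embed U (∅ (card U))))
  emptyFace′ rewrite embed-∅ U = emptyFace Γ

_⊔ᶜ_ : ∀ {n m} → Complex n → Complex m → Complex (n + m)
_⊔ᶜ_ {n} {m} Γ Δ = record
  { face       = fc
  ; emptyFace  = ef
  ; downClosed = dc
  }
  where
  fc : Subset (n + m) → Bool
  fc Z = (face Γ (proj₁ (split n Z)) ∧ isEmpty (proj₂ (split n Z)))
       ∨ (isEmpty (proj₁ (split n Z)) ∧ face Δ (proj₂ (split n Z)))
  ef : T (fc (∅ (n + m)))
  ef rewrite split-∅ n {m} = T-∨-l (T-∧-intro (emptyFace Γ) (isEmpty-∅ m))
  dc : ∀ {X Y} → X ⊑ Y → T (fc Y) → T (fc X)
  dc p t = let (a , b) = split-mono n p in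
    T-∨-elim t
      (λ u → T-∨-l (T-∧-intro (downClosed Γ a (T-∧-l u)) (isEmpty-mono b (T-∧-r u))))
      (λ u → T-∨-r (T-∧-intro (isEmpty-mono a (T-∧-l u)) (downClosed Δ b (T-∧-r u))))

-- the k-skeleton Γ^(k): faces of dimension (= size − 1) at most k
skeleton : ∀ {n} → ℕ → Complex n → Complex n
skeleton {n} k Γ = record
  { face       = λ X → face Γ X ∧ (card X ≤ᵇ suc k)
  ; emptyFace  = T-∧-intro (emptyFace Γ) (≤⇒≤ᵇ (card-∅ n))
  ; downClosed = λ p t → T-∧-intro (downClosed Γ p (T-∧-l t))
                           (≤⇒≤ᵇ (≤-trans (card-mono p) (≤ᵇ⇒≤ _ _ (T-∧-r t))))
  }
  where
  card-∅ : ∀ n → card (∅ n) ℕ.≤ suc k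
  card-∅ zero    = z≤n
  card-∅ (suc n) = card-∅ n

image : ∀ {n m} → Fin n ↔ Fin m → Subset n → Subset m
image σ X = tabulate (λ j → lookup X (Inverse.from σ j))

record _≅_ {n m} (Γ : Complex n) (Δ : Complex m) : Set where
  field
    σ        : Fin n ↔ Fin m
    preserve : ∀ X → face Δ (image σ X) ≡ face Γ X

SC : Set
SC = Σ ℕ Complex

module HopfAlgebra {c ℓ} (𝕂 : Field c ℓ) where
  open Field 𝕂 using (Carrier; _≈_; _*_; 0#; 1#; -_) renaming (_+_ to _+ᴷ_)

  LinComb : Set c
  LinComb = List (Carrier × SC)

  ⟪_,_⟫ : (SC → Carrier) → LinComb → Carrier
  ⟪ φ , u ⟫ = foldr (λ t acc → (proj₁ t * φ (proj₂ t)) +ᴷ acc) 0# u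

  Invariant : (SC → Carrier) → Set ℓ
  Invariant φ = ∀ {n m} (Γ : Complex n) (Δ : Complex m) → Γ ≅ Δ → φ (n , Γ) ≈ φ (m , Δ)

  -- equality in 𝒜: two formal combinations are equal iff they define the
  -- same element of the free 𝕂-vector space on isomorphism classes, i.e.
  -- every isomorphism-invariant coefficient functional agrees on them
  -- (in particular each isomorphism class receives the same total coefficient)
  _≈𝒜_ : LinComb → LinComb → Set (c ⊔ ℓ)
  u ≈𝒜 v = ∀ (φ : SC → Carrier) → Invariant φ → ⟪ φ , u ⟫ ≈ ⟪ φ , v ⟫

  basis : SC → LinComb
  basis Γ = [ (1# , Γ) ]

  negate : LinComb → LinComb
  negate = L.map (λ t → (- proj₁ t) , proj₂ t)

  _·_ : LinComb → LinComb → LinComb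
  u · v = concatMap (λ s → L.map (λ t → (proj₁ s * proj₁ t) ,
                     (_ , (proj₂ (proj₂ s) ⊔ᶜ proj₂ (proj₂ t)))) v) u

  -- the antipode, via the defining recursion of the antipode of the
  -- connected graded bialgebra 𝒜:  S(Γ) = Γ  if V(Γ) = ∅ (the unit), and
  --   S(Γ) = − Σ_{∅ ≠ T ⊆ V(Γ)} Γ_T · S(Γ_{V(Γ) − T})   otherwise,
  -- which is  m ∘ (id ⊗ S) ∘ Δ = η ∘ ε  solved for S(Γ).
  -- The first argument is a recursion bound (number of vertices suffices).
  antipode′ : ℕ → ∀ {n} → Complex n → LinComb
  antipode′ _       {zero}  Γ = basis (zero , Γ)
  antipode′ zero    {suc n} Γ = []
  antipode′ (suc f) {suc n} Γ =
    negate (concatMap (λ U → basis (_ , restrict Γ U) · antipode′ f (restrict Γ (∁ U)))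
                      (nonemptySubsets (suc n)))

  S : ∀ {n} → Complex n → LinComb
  S {n} Γ = antipode′ n Γ

  skeletonLin : ℕ → LinComb → LinComb
  skeletonLin k = L.map (λ t → proj₁ t , (proj₁ (proj₂ t) , skeleton k (proj₂ (proj₂ t))))

{-# OPTIONS --safe #-}
-- The k-skeleton commutes with restrictions Γ_T and with disjoint unions, so
-- it induces a Hopf algebra endomorphism of 𝒜, and such endomorphisms commute
-- with the antipode.  Concretely, induction along the recursion
-- S(Γ) = − Σ_{T ≠ ∅} Γ_T · S(Γ_{V−T}) shows that S(Γ^(k)) is S(Γ) with every
-- complex replaced by its k-skeleton, term by term; since skeleta of
-- isomorphic complexes are isomorphic, equalities in 𝒜 survive this.
module Submission where

open import Defs
open import Level using (Level; 0ℓ)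
open import Data.Nat using (ℕ; zero; suc; _+_; _≤ᵇ_)
open import Data.Bool using (Bool; true; false; _∧_; _∨_; T)
open import Data.Bool.Properties using (∧-assoc; ∧-comm; ∧-distribʳ-∨)
open import Data.Nat.Properties using (+-identityʳ; +-0-commutativeMonoid)
open import Data.Fin using (Fin)
import Data.Fin as Fin
open import Data.Fin.Subset using (Subset)
open import Data.Vec using ([]; _∷_; tabulate; lookup)
open import Data.Vec.Properties using (tabulate∘lookup)
open import Data.List using ([]; _∷_; concatMap)
import Data.List as List
open import Data.List.Properties using (map-++; map-∘; map-concatMap; foldr-map)
import Data.List.Relation.Binary.Pointwise as Pointwise
open Pointwise using ([]; _∷_)
open import Data.Product using (_×_; _,_; proj₁; proj₂; map₂)
open import Data.Product.Relation.Binary.Pointwise.NonDependent using (_×ₛ_)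
open import Function using (_∘_)
open import Function.Bundles using (_↔_; Inverse)
open import Function.Properties.Inverse using (↔-refl; ↔-sym)
open import Relation.Binary.Bundles using (Setoid)
open import Relation.Binary.PropositionalEquality
import Relation.Binary.Reasoning.Setoid as SetoidReasoning
open import Algebra.Properties.CommutativeMonoid.Sum +-0-commutativeMonoid
  using (sum; sum-permute)

card-∷ : ∀ {n} b (X : Subset n) → card (b ∷ X) ≡ card (b ∷ []) + card X
card-∷ true  X = refl
card-∷ false X = refl

card-tabulate : ∀ {n} (g : Fin n → Bool) → card (tabulate g) ≡ sum (λ i → card (g i ∷ []))
card-tabulate {zero}  g = refl
card-tabulate {suc n} g =
  trans (card-∷ (g Fin.zero) _) (cong (card (g Fin.zero ∷ []) +_) (card-tabulate (g ∘ Fin.suc)))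

card-image : ∀ {n m} (σ : Fin n ↔ Fin m) (X : Subset n) → card (image σ X) ≡ card X
card-image σ X = begin
  card (image σ X)                                     ≡⟨ card-tabulate (lookup X ∘ Inverse.from σ) ⟩
  sum (λ j → card (lookup X (Inverse.from σ j) ∷ []))  ≡⟨ sum-permute (λ i → card (lookup X i ∷ [])) (↔-sym σ) ⟨
  sum (λ i → card (lookup X i ∷ []))                   ≡⟨ card-tabulate (lookup X) ⟨
  card (tabulate (lookup X))                           ≡⟨ cong card (tabulate∘lookup X) ⟩
  card X                                               ∎
  where open ≡-Reasoning

card-embed : ∀ {n} (U : Subset n) Y → card (embed U Y) ≡ card Y
card-embed []          []          = refl
card-embed (true ∷ U)  (true ∷ Y)  = cong suc (card-embed U Y)
card-embed (true ∷ U)  (false ∷ Y) = card-embed U Y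
card-embed (false ∷ U) Y           = card-embed U Y

card-split : ∀ n {m} (Z : Subset (n + m)) →
             card Z ≡ card (proj₁ (split n Z)) + card (proj₂ (split n Z))
card-split zero    Z           = refl
card-split (suc n) (true ∷ Z)  = cong suc (card-split n Z)
card-split (suc n) (false ∷ Z) = card-split n Z

isEmpty⇒card≡0 : ∀ {n} (X : Subset n) → T (isEmpty X) → card X ≡ 0
isEmpty⇒card≡0 []          _ = refl
isEmpty⇒card≡0 (false ∷ X) e = isEmpty⇒card≡0 X e

card-split-emptyˡ : ∀ n {m} (Z : Subset (n + m)) →
                    T (isEmpty (proj₁ (split n Z))) → card Z ≡ card (proj₂ (split n Z))
card-split-emptyˡ n Z εX = trans (card-split n Z) (cong (_+ card Y) (isEmpty⇒card≡0 X εX))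
  where
  X = proj₁ (split n Z)
  Y = proj₂ (split n Z)

card-split-emptyʳ : ∀ n {m} (Z : Subset (n + m)) →
                    T (isEmpty (proj₂ (split n Z))) → card Z ≡ card (proj₁ (split n Z))
card-split-emptyʳ n Z εY = begin
  card Z           ≡⟨ card-split n Z ⟩
  card X + card Y  ≡⟨ cong (card X +_) (isEmpty⇒card≡0 Y εY) ⟩
  card X + 0       ≡⟨ +-identityʳ (card X) ⟩
  card X           ∎
  where
  open ≡-Reasoning
  X = proj₁ (split n Z)
  Y = proj₂ (split n Z)

∧-cong-under : ∀ b {x y} → (T b → x ≡ y) → b ∧ x ≡ b ∧ y
∧-cong-under true  x≡y = x≡y _
∧-cong-under false _   = refl

-- A record rather than face Γ ≗ face Δ, so that Γ and Δ stay inferable.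
record _≈ᶜ_ {n} (Γ Δ : Complex n) : Set where
  constructor same-faces
  field faces-≗ : face Γ ≗ face Δ

≈ᶜ-refl : ∀ {n} {Γ : Complex n} → Γ ≈ᶜ Γ
≈ᶜ-refl = same-faces (λ _ → refl)

≈ᶜ-sym : ∀ {n} {Γ Δ : Complex n} → Γ ≈ᶜ Δ → Δ ≈ᶜ Γ
≈ᶜ-sym (same-faces Γ≗Δ) = same-faces (sym ∘ Γ≗Δ)

≈ᶜ-trans : ∀ {n} {Γ Δ Θ : Complex n} → Γ ≈ᶜ Δ → Δ ≈ᶜ Θ → Γ ≈ᶜ Θ
≈ᶜ-trans (same-faces Γ≗Δ) (same-faces Δ≗Θ) = same-faces (λ X → trans (Γ≗Δ X) (Δ≗Θ X))

≈ᶜ⇒≅ : ∀ {n} {Γ Δ : Complex n} → Γ ≈ᶜ Δ → Γ ≅ Δ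
≈ᶜ⇒≅ {Δ = Δ} (same-faces Γ≗Δ) = record
  { σ        = ↔-refl
  ; preserve = λ X → trans (cong (face Δ) (tabulate∘lookup X)) (sym (Γ≗Δ X))
  }

restrict-cong : ∀ {n} {Γ Δ : Complex n} → Γ ≈ᶜ Δ → ∀ U → restrict Γ U ≈ᶜ restrict Δ U
restrict-cong (same-faces Γ≗Δ) U = same-faces (Γ≗Δ ∘ embed U)

⊔ᶜ-cong : ∀ {n m} {Γ Γ′ : Complex n} {Δ Δ′ : Complex m} →
          Γ ≈ᶜ Γ′ → Δ ≈ᶜ Δ′ → (Γ ⊔ᶜ Δ) ≈ᶜ (Γ′ ⊔ᶜ Δ′)
⊔ᶜ-cong {n} (same-faces Γ≗Γ′) (same-faces Δ≗Δ′) = same-faces λ Z →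
  cong₂ (λ γ δ → (γ ∧ isEmpty (proj₂ (split n Z))) ∨ (isEmpty (proj₁ (split n Z)) ∧ δ))
        (Γ≗Γ′ (proj₁ (split n Z))) (Δ≗Δ′ (proj₂ (split n Z)))

module _ (k : ℕ) where

  skeleton-≅ : ∀ {n m} {Γ : Complex n} {Δ : Complex m} → Γ ≅ Δ → skeleton k Γ ≅ skeleton k Δ
  skeleton-≅ Γ≅Δ = record
    { σ        = σ
    ; preserve = λ X → cong₂ _∧_ (preserve X) (cong (_≤ᵇ suc k) (card-image σ X))
    }
    where open _≅_ Γ≅Δ

  skeleton-restrict : ∀ {n} (Γ : Complex n) U → skeleton k (restrict Γ U) ≈ᶜ restrict (skeleton k Γ) U
  skeleton-restrict Γ U = same-faces λ Y →
    cong (λ c → face Γ (embed U Y) ∧ (c ≤ᵇ suc k)) (sym (card-embed U Y))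

  skeleton-⊔ᶜ : ∀ {n m} (Γ : Complex n) (Δ : Complex m) →
                skeleton k (Γ ⊔ᶜ Δ) ≈ᶜ (skeleton k Γ ⊔ᶜ skeleton k Δ)
  skeleton-⊔ᶜ {n} Γ Δ = same-faces faces-agree
    where
    faces-agree : face (skeleton k (Γ ⊔ᶜ Δ)) ≗ face (skeleton k Γ ⊔ᶜ skeleton k Δ)
    faces-agree Z = begin
      ((γ ∧ εY) ∨ (εX ∧ δ)) ∧ small Z            ≡⟨ ∧-distribʳ-∨ (small Z) (γ ∧ εY) (εX ∧ δ) ⟩
      ((γ ∧ εY) ∧ small Z) ∨ ((εX ∧ δ) ∧ small Z) ≡⟨ cong₂ _∨_ Γ-part Δ-part ⟩
      ((γ ∧ small X) ∧ εY) ∨ (εX ∧ (δ ∧ small Y)) ∎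
      where
      open ≡-Reasoning
      X = proj₁ (split n Z)
      Y = proj₂ (split n Z)
      γ = face Γ X
      δ = face Δ Y
      εX = isEmpty X
      εY = isEmpty Y
      small : ∀ {l} → Subset l → Bool
      small W = card W ≤ᵇ suc k

      Γ-part : (γ ∧ εY) ∧ small Z ≡ (γ ∧ small X) ∧ εY
      Γ-part = begin
        (γ ∧ εY) ∧ small Z  ≡⟨ ∧-assoc γ εY (small Z) ⟩
        γ ∧ (εY ∧ small Z)  ≡⟨ cong (γ ∧_) (∧-cong-under εY (cong (_≤ᵇ suc k) ∘ card-split-emptyʳ n Z)) ⟩
        γ ∧ (εY ∧ small X)  ≡⟨ cong (γ ∧_) (∧-comm εY (small X)) ⟩
        γ ∧ (small X ∧ εY)  ≡⟨ ∧-assoc γ (small X) εY ⟨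
        (γ ∧ small X) ∧ εY  ∎

      Δ-part : (εX ∧ δ) ∧ small Z ≡ εX ∧ (δ ∧ small Y)
      Δ-part = begin
        (εX ∧ δ) ∧ small Z  ≡⟨ ∧-assoc εX δ (small Z) ⟩
        εX ∧ (δ ∧ small Z)  ≡⟨ ∧-cong-under εX (cong (λ c → δ ∧ (c ≤ᵇ suc k)) ∘ card-split-emptyˡ n Z) ⟩
        εX ∧ (δ ∧ small Y)  ∎

data _≋_ : SC → SC → Set where
  ≈ᶜ⇒≋ : ∀ {n} {Γ Δ : Complex n} → Γ ≈ᶜ Δ → (n , Γ) ≋ (n , Δ)

≋-setoid : Setoid 0ℓ 0ℓ
≋-setoid = record
  { Carrier       = SC
  ; _≈_           = _≋_
  ; isEquivalence = record { refl = ≋-refl ; sym = ≋-sym ; trans = ≋-trans }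
  }
  where
  ≋-refl : ∀ {x} → x ≋ x
  ≋-refl {_ , _} = ≈ᶜ⇒≋ ≈ᶜ-refl
  ≋-sym : ∀ {x y} → x ≋ y → y ≋ x
  ≋-sym (≈ᶜ⇒≋ Γ≈Δ) = ≈ᶜ⇒≋ (≈ᶜ-sym Γ≈Δ)
  ≋-trans : ∀ {x y z} → x ≋ y → y ≋ z → x ≋ z
  ≋-trans (≈ᶜ⇒≋ Γ≈Δ) (≈ᶜ⇒≋ Δ≈Θ) = ≈ᶜ⇒≋ (≈ᶜ-trans Γ≈Δ Δ≈Θ)

module LinCombProperties {c ℓ} (𝕂 : Field c ℓ) where
  open HopfAlgebra 𝕂
  open Field 𝕂 using (Carrier; _≈_; _*_; -_; +-cong; *-congˡ) renaming (refl to ≈-refl)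

  Term-setoid : Setoid c c
  Term-setoid = setoid Carrier ×ₛ ≋-setoid

  LinComb-setoid : Setoid c c
  LinComb-setoid = Pointwise.setoid Term-setoid

  open Setoid Term-setoid public using () renaming (_≈_ to _≈ₜ_)
  open Setoid LinComb-setoid public using () renaming (_≈_ to _≋ᴸ_)

  _⊗_ : Carrier × SC → Carrier × SC → Carrier × SC
  s ⊗ t = proj₁ s * proj₁ t , (_ , (proj₂ (proj₂ s) ⊔ᶜ proj₂ (proj₂ t)))

  ⊗-cong : ∀ {s s′ t t′} → s ≈ₜ s′ → t ≈ₜ t′ → (s ⊗ t) ≈ₜ (s′ ⊗ t′)
  ⊗-cong (refl , ≈ᶜ⇒≋ Γ≈Γ′) (refl , ≈ᶜ⇒≋ Δ≈Δ′) = refl , ≈ᶜ⇒≋ (⊔ᶜ-cong Γ≈Γ′ Δ≈Δ′)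

  negate-cong : ∀ {u v} → u ≋ᴸ v → negate u ≋ᴸ negate v
  negate-cong []                   = []
  negate-cong ((refl , x≋y) ∷ u≋v) = (refl , x≋y) ∷ negate-cong u≋v

  ·-cong : ∀ {u u′ v v′} → u ≋ᴸ u′ → v ≋ᴸ v′ → (u · v) ≋ᴸ (u′ · v′)
  ·-cong []                        v≋v′ = []
  ·-cong (_∷_ {s} {s′} s≈s′ u≋u′) v≋v′ =
    Pointwise.++⁺ (Pointwise.map⁺ (s ⊗_) (s′ ⊗_) (Pointwise.map (⊗-cong s≈s′) v≋v′))
                  (·-cong u≋u′ v≋v′)

  concatMap⁺ : ∀ {A : Set} {f g : A → LinComb} → (∀ x → f x ≋ᴸ g x) →
               ∀ xs → concatMap f xs ≋ᴸ concatMap g xs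
  concatMap⁺ f≋g []       = []
  concatMap⁺ f≋g (x ∷ xs) = Pointwise.++⁺ (f≋g x) (concatMap⁺ f≋g xs)

  ⟪⟫-cong : ∀ {φ} → Invariant φ → ∀ {u v} → u ≋ᴸ v → ⟪ φ , u ⟫ ≈ ⟪ φ , v ⟫
  ⟪⟫-cong inv []                        = ≈-refl
  ⟪⟫-cong inv ((refl , ≈ᶜ⇒≋ Γ≈Δ) ∷ u≋v) = +-cong (*-congˡ (inv _ _ (≈ᶜ⇒≅ Γ≈Δ))) (⟪⟫-cong inv u≋v)

module AntipodeNaturality
  {c ℓ} (𝕂 : Field c ℓ)
  (F : ∀ {n} → Complex n → Complex n)
  (F-≅        : ∀ {n m} {Γ : Complex n} {Δ : Complex m} → Γ ≅ Δ → F Γ ≅ F Δ)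
  (F-restrict : ∀ {n} (Γ : Complex n) U → F (restrict Γ U) ≈ᶜ restrict (F Γ) U)
  (F-⊔ᶜ       : ∀ {n m} (Γ : Complex n) (Δ : Complex m) → F (Γ ⊔ᶜ Δ) ≈ᶜ (F Γ ⊔ᶜ F Δ))
  where

  open HopfAlgebra 𝕂
  open LinCombProperties 𝕂
  open Field 𝕂 using () renaming (setoid to 𝕂-setoid)

  F̂ : SC → SC
  F̂ (n , Γ) = n , F Γ

  mapLin : LinComb → LinComb
  mapLin = List.map (map₂ F̂)

  mapLin-negate : ∀ u → mapLin (negate u) ≡ negate (mapLin u)
  mapLin-negate u = trans (sym (map-∘ u)) (map-∘ u)

  mapLin-· : ∀ u v → mapLin (u · v) ≋ᴸ (mapLin u · mapLin v)
  mapLin-· []      v = []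
  mapLin-· (s ∷ u) v rewrite map-++ (map₂ F̂) (List.map (s ⊗_) v) (u · v) =
    Pointwise.++⁺ (F̂-⊗ v) (mapLin-· u v)
    where
    F̂-⊗ : ∀ v → mapLin (List.map (s ⊗_) v) ≋ᴸ List.map (map₂ F̂ s ⊗_) (mapLin v)
    F̂-⊗ []      = []
    F̂-⊗ (t ∷ v) = (refl , ≈ᶜ⇒≋ (F-⊔ᶜ (proj₂ (proj₂ s)) (proj₂ (proj₂ t)))) ∷ F̂-⊗ v

  antipode′-natural : ∀ fuel {n} {Γ′ Γ : Complex n} → Γ′ ≈ᶜ F Γ →
                      antipode′ fuel Γ′ ≋ᴸ mapLin (antipode′ fuel Γ)
  antipode′-natural _          {zero}  Γ′≈FΓ = (refl , ≈ᶜ⇒≋ Γ′≈FΓ) ∷ []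
  antipode′-natural zero       {suc n} Γ′≈FΓ = []
  antipode′-natural (suc fuel) {suc n} {Γ′} {Γ} Γ′≈FΓ = begin
    negate (concatMap (summand Γ′) Us)          ≈⟨ negate-cong (concatMap⁺ summand-natural Us) ⟩
    negate (concatMap (mapLin ∘ summand Γ) Us)  ≡⟨ cong negate (map-concatMap (map₂ F̂) (summand Γ) Us) ⟨
    negate (mapLin (concatMap (summand Γ) Us))  ≡⟨ mapLin-negate (concatMap (summand Γ) Us) ⟨
    mapLin (negate (concatMap (summand Γ) Us))  ∎
    where
    open SetoidReasoning LinComb-setoid
    Us = nonemptySubsets (suc n)
    summand : Complex (suc n) → Subset (suc n) → LinComb
    summand Θ U = basis (_ , restrict Θ U) · antipode′ fuel (restrict Θ (∁ U))

    restrict-natural : ∀ U → restrict Γ′ U ≈ᶜ F (restrict Γ U)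
    restrict-natural U = ≈ᶜ-trans (restrict-cong Γ′≈FΓ U) (≈ᶜ-sym (F-restrict Γ U))

    summand-natural : ∀ U → summand Γ′ U ≋ᴸ mapLin (summand Γ U)
    summand-natural U = begin
      summand Γ′ U
        ≈⟨ ·-cong ((refl , ≈ᶜ⇒≋ (restrict-natural U)) ∷ [])
                  (antipode′-natural fuel (restrict-natural (∁ U))) ⟩
      mapLin (basis (_ , restrict Γ U)) · mapLin (antipode′ fuel (restrict Γ (∁ U)))
        ≈⟨ mapLin-· (basis (_ , restrict Γ U)) (antipode′ fuel (restrict Γ (∁ U))) ⟨
      mapLin (summand Γ U)
        ∎

  ⟪⟫-mapLin : ∀ φ u → ⟪ φ , mapLin u ⟫ ≡ ⟪ φ ∘ F̂ , u ⟫
  ⟪⟫-mapLin φ u = foldr-map _ (map₂ F̂) _ u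

  Invariant-∘F̂ : ∀ {φ} → Invariant φ → Invariant (φ ∘ F̂)
  Invariant-∘F̂ inv Γ Δ = inv (F Γ) (F Δ) ∘ F-≅

  S-natural : ∀ {n} (Γ : Complex n) cs → S Γ ≈𝒜 cs → S (F Γ) ≈𝒜 mapLin cs
  S-natural {n} Γ cs SΓ≈cs φ inv = begin
    ⟪ φ , S (F Γ) ⟫       ≈⟨ ⟪⟫-cong inv (antipode′-natural n {Γ = Γ} ≈ᶜ-refl) ⟩
    ⟪ φ , mapLin (S Γ) ⟫  ≡⟨ ⟪⟫-mapLin φ (S Γ) ⟩
    ⟪ φ ∘ F̂ , S Γ ⟫       ≈⟨ SΓ≈cs (φ ∘ F̂) (Invariant-∘F̂ inv) ⟩
    ⟪ φ ∘ F̂ , cs ⟫        ≡⟨ ⟪⟫-mapLin φ cs ⟨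
    ⟪ φ , mapLin cs ⟫     ∎
    where open SetoidReasoning 𝕂-setoid

corollary3p3 : ∀ {c ℓ : Level} (𝕂 : Field c ℓ) → let open HopfAlgebra 𝕂 in
    ∀ {n} (Γ : Complex n) (k : ℕ) (cs : LinComb) →
    S Γ ≈𝒜 cs → S (skeleton k Γ) ≈𝒜 skeletonLin k cs
corollary3p3 𝕂 Γ k = S-natural Γ
  where open AntipodeNaturality 𝕂 (skeleton k) (skeleton-≅ k) (skeleton-restrict k) (skeleton-⊔ᶜ k)
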